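{- Let $A$ and $B$ be arch systems whose associated plane forests are isomorphic as non-plane rooted forests (i.e. there is a bijection between their node sets that maps roots to roots and preserves the parent relation, ignoring the left-to-right order of trees and of children). Then $A \sim B$.
   Context: An arch system of size $n$ is a set of $n$ non-crossing arches above a horizontal baseline connecting $2n$ points, each point being an endpoint of exactly one arch (only the combinatorial configuration matters); the empty arch system has size $0$. Concatenation $AB$ places $B$ to the right of $A$. An atom is a non-empty arch system not expressible as a concatenation of two non-empty arch systems; every atom is $\langle A\rangle$, obtained from its contents $A$ by adding one enclosing arch. Every arch system factors uniquely as a concatenation of atoms $a_1\cdots a_m$. The plane forest associated with $a_1\cdots a_m$ consists of $m$ trees ordered left to right, the $i$-th tree having a root whose ordered subforest is the plane forest associated with the contents of $a_i$ (the empty system gives the empty forest). The relation $\sim$ is the finest equivalence relation on arch systems such that, for all arch systems $A,B,P,Q$ and all $a,b,c$ each of which is an atom or empty: (R1) $A\sim B \Rightarrow \langle A\rangle\sim\langle B\rangle$; (R2) $a\sim b \Rightarrow PaQ\sim PbQ$; (R3) $PabQ\sim PbaQ$; (R4) $a\langle bc\rangle \sim \langle ab\rangle c$. -}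

module Defs where

open import Data.List using (List; []; _∷_; _++_)
open import Data.Maybe using (Maybe; just; nothing)
open import Data.Product using (Σ; _×_)
open import Function.Bundles using (_⤖_; _⇔_; Bijection)

-- An arch system is determined (combinatorially) by its unique
-- factorisation into atoms, and each atom is ⟨ A ⟩ for its contents A.
-- So we represent an arch system as a finite list of atoms, and an atom
-- by its contents. The empty arch system is [], concatenation is _++_.

data Atom : Set where
  ⟨_⟩ : List Atom → Atom

ArchSystem : Set
ArchSystem = List Atom

enc : ArchSystem → ArchSystem
enc A = ⟨ A ⟩ ∷ []

AtomOrEmpty : Set
AtomOrEmpty = Maybe Atom

⌊_⌋ : AtomOrEmpty → ArchSystem
⌊ just a ⌋  = a ∷ []
⌊ nothing ⌋ = []

infix 4 _∼_

data _∼_ : ArchSystem → ArchSystem → Set where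
  ∼-refl  : ∀ {A} → A ∼ A
  ∼-sym   : ∀ {A B} → A ∼ B → B ∼ A
  ∼-trans : ∀ {A B C} → A ∼ B → B ∼ C → A ∼ C
  R1 : ∀ {A B} → A ∼ B → enc A ∼ enc B
  R2 : ∀ {P Q : ArchSystem} {a b : AtomOrEmpty} →
       ⌊ a ⌋ ∼ ⌊ b ⌋ → P ++ ⌊ a ⌋ ++ Q ∼ P ++ ⌊ b ⌋ ++ Q
  R3 : ∀ (P Q : ArchSystem) (a b : AtomOrEmpty) →
       P ++ ⌊ a ⌋ ++ ⌊ b ⌋ ++ Q ∼ P ++ ⌊ b ⌋ ++ ⌊ a ⌋ ++ Q
  R4 : ∀ (a b c : AtomOrEmpty) →
       ⌊ a ⌋ ++ enc (⌊ b ⌋ ++ ⌊ c ⌋) ∼ enc (⌊ a ⌋ ++ ⌊ b ⌋) ++ ⌊ c ⌋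

data PlaneTree : Set where
  node : List PlaneTree → PlaneTree

PlaneForest : Set
PlaneForest = List PlaneTree

mutual
  forestOf : ArchSystem → PlaneForest
  forestOf []       = []
  forestOf (a ∷ as) = treeOf a ∷ forestOf as

  treeOf : Atom → PlaneTree
  treeOf ⟨ A ⟩ = node (forestOf A)

data Node : PlaneForest → Set where
  root   : ∀ {f ts} → Node (node f ∷ ts)
  inside : ∀ {f ts} → Node f → Node (node f ∷ ts)
  later  : ∀ {t ts} → Node ts → Node (t ∷ ts)

data IsRoot : {F : PlaneForest} → Node F → Set where
  root-isRoot  : ∀ {f ts} → IsRoot (root {f} {ts})
  later-isRoot : ∀ {t ts} {x : Node ts} → IsRoot x → IsRoot (later {t} x)

-- Parent x y : y is the parent of x
data Parent : {F : PlaneForest} → Node F → Node F → Set where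
  top  : ∀ {f ts} {x : Node f} → IsRoot x →
         Parent (inside {f} {ts} x) root
  deep : ∀ {f ts} {x y : Node f} → Parent x y →
         Parent (inside {f} {ts} x) (inside y)
  next : ∀ {t ts} {x y : Node ts} → Parent x y →
         Parent (later {t} x) (later y)

record NonPlaneIso (F G : PlaneForest) : Set where
  field
    bij        : Node F ⤖ Node G
  open Bijection bij public using (to)
  field
    root-pres   : ∀ x → IsRoot x ⇔ IsRoot (to x)
    parent-pres : ∀ x y → Parent x y ⇔ Parent (to x) (to y)

-- Rules R1–R3 alone suffice. R3 swaps adjacent atoms inside
-- any context and R1, R2 replace an atom by an equivalent one, so arch systems
-- whose forests differ only by reordering the trees at every level are
-- equivalent. A non-plane isomorphism restricts, for every node, to a bijection
-- between its children and the children of its image; both children lists are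
-- duplicate-free, so one is a permutation of the image of the other, and
-- induction on the trees turns the isomorphism into such a reordering.
module Submission where

open import Defs
open import Data.List using (List; []; _∷_; _++_; map)
open import Data.List.Properties using (++-assoc; ++-identityʳ; map-∘; ∷-injective)
open import Data.Maybe using (just)
open import Data.Product using (_×_; _,_; proj₁; proj₂)
open import Function.Bundles using (_⤖_; _⇔_; Bijection; Surjection; mk⇔; Equivalence)
open import Relation.Binary.PropositionalEquality as ≡
  using (_≡_; _≢_; refl; sym; cong; cong₂; subst; subst₂)
open import Data.List.Membership.Propositional using (_∈_)
open import Data.List.Membership.Propositional.Properties using (∈-map⁺; ∈-map⁻)
open import Data.List.Membership.Propositional.Properties.WithK using (unique∧set⇒bag)
open import Data.List.Relation.Unary.Any using (here; there)
open import Data.List.Relation.Unary.All using (All; []; _∷_)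
open import Data.List.Relation.Unary.AllPairs using ([]; _∷_)
open import Data.List.Relation.Unary.Unique.Propositional using (Unique)
import Data.List.Relation.Unary.Unique.Propositional.Properties as Unique
open import Data.List.Relation.Binary.Permutation.Propositional as ↭ using (_↭_)
import Data.List.Relation.Binary.Permutation.Propositional.Properties as ↭
open import Data.List.Relation.Binary.BagAndSetEquality using (∼bag⇒↭)

infix 4 _≋_

_≋_ : ArchSystem → ArchSystem → Set
A ≋ B = ∀ X Y → X ++ A ++ Y ∼ X ++ B ++ Y

≋-refl : ∀ {A} → A ≋ A
≋-refl X Y = ∼-refl

≋-trans : ∀ {A B C} → A ≋ B → B ≋ C → A ≋ C
≋-trans p q X Y = ∼-trans (p X Y) (q X Y)

≋⇒∼ : ∀ {A B} → A ≋ B → A ∼ B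
≋⇒∼ {A} {B} p = subst₂ _∼_ (++-identityʳ A) (++-identityʳ B) (p [] [])

++-≋ : ∀ {A A′ B B′} → A ≋ A′ → B ≋ B′ → A ++ B ≋ A′ ++ B′
++-≋ {A} {A′} {B} {B′} p q X Y = ∼-trans left right
  where
  left : X ++ (A ++ B) ++ Y ∼ X ++ (A′ ++ B) ++ Y
  left = subst₂ _∼_ (cong (X ++_) (sym (++-assoc A B Y)))
                    (cong (X ++_) (sym (++-assoc A′ B Y)))
                    (p X (B ++ Y))

  right : X ++ (A′ ++ B) ++ Y ∼ X ++ (A′ ++ B′) ++ Y
  right = subst₂ _∼_ (reassoc B) (reassoc B′) (q (X ++ A′) Y)
    where
    reassoc : ∀ C → (X ++ A′) ++ C ++ Y ≡ X ++ (A′ ++ C) ++ Y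
    reassoc C = ≡.trans (++-assoc X A′ (C ++ Y))
                        (cong (X ++_) (sym (++-assoc A′ C Y)))

enc-≋ : ∀ {A B} → A ∼ B → enc A ≋ enc B
enc-≋ p X Y = R2 {P = X} {Q = Y} {a = just _} {b = just _} (R1 p)

swap-≋ : ∀ a b → a ∷ b ∷ [] ≋ b ∷ a ∷ []
swap-≋ a b X Y = R3 X Y (just a) (just b)

↭⇒≋ : ∀ {A B} → A ↭ B → A ≋ B
↭⇒≋ ↭.refl          = ≋-refl
↭⇒≋ (↭.prep a p)    = ++-≋ (≋-refl {a ∷ []}) (↭⇒≋ p)
↭⇒≋ (↭.swap a b p)  = ++-≋ (swap-≋ a b) (↭⇒≋ p)
↭⇒≋ (↭.trans p q)   = ≋-trans (↭⇒≋ p) (↭⇒≋ q)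

infix 4 _≈T_ _≈F_

mutual
  data _≈T_ : PlaneTree → PlaneTree → Set where
    node≈ : ∀ {f g} → f ≈F g → node f ≈T node g

  data _≈F_ : PlaneForest → PlaneForest → Set where
    []      : [] ≈F []
    _∷_     : ∀ {t u f g} → t ≈T u → f ≈F g → t ∷ f ≈F u ∷ g
    permute : ∀ {f g} → f ↭ g → f ≈F g
    ≈F-trans : ∀ {f g h} → f ≈F g → g ≈F h → f ≈F h

mutual
  archOf : PlaneForest → ArchSystem
  archOf []       = []
  archOf (t ∷ ts) = atomOf t ∷ archOf ts

  atomOf : PlaneTree → Atom
  atomOf (node f) = ⟨ archOf f ⟩

mutual
  archOf-forestOf : ∀ A → archOf (forestOf A) ≡ A
  archOf-forestOf []       = refl
  archOf-forestOf (a ∷ as) = cong₂ _∷_ (atomOf-treeOf a) (archOf-forestOf as)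

  atomOf-treeOf : ∀ a → atomOf (treeOf a) ≡ a
  atomOf-treeOf ⟨ A ⟩ = cong ⟨_⟩ (archOf-forestOf A)

archOf≗map : ∀ f → archOf f ≡ map atomOf f
archOf≗map []      = refl
archOf≗map (t ∷ f) = cong (atomOf t ∷_) (archOf≗map f)

archOf-↭ : ∀ {f g} → f ↭ g → archOf f ↭ archOf g
archOf-↭ {f} {g} p =
  subst₂ _↭_ (sym (archOf≗map f)) (sym (archOf≗map g)) (↭.map⁺ atomOf p)

mutual
  ≈T⇒≋ : ∀ {t u} → t ≈T u → atomOf t ∷ [] ≋ atomOf u ∷ []
  ≈T⇒≋ (node≈ p) = enc-≋ (≋⇒∼ (≈F⇒≋ p))

  ≈F⇒≋ : ∀ {f g} → f ≈F g → archOf f ≋ archOf g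
  ≈F⇒≋ []             = ≋-refl
  ≈F⇒≋ (p ∷ q)        = ++-≋ (≈T⇒≋ p) (≈F⇒≋ q)
  ≈F⇒≋ (permute p)    = ↭⇒≋ (archOf-↭ p)
  ≈F⇒≋ (≈F-trans p q) = ≋-trans (≈F⇒≋ p) (≈F⇒≋ q)

Enumerates : {A : Set} → (A → Set) → List A → Set
Enumerates P xs = Unique xs × (∀ {x} → x ∈ xs ⇔ P x)

map-enumerates-↭ : ∀ {A B : Set} {P : A → Set} {Q : B → Set} {xs ys}
                   (φ : A ⤖ B) → (∀ x → P x ⇔ Q (Bijection.to φ x)) →
                   Enumerates P xs → Enumerates Q ys → map (Bijection.to φ) xs ↭ ys
map-enumerates-↭ {P = P} {Q} {xs} {ys} φ P⇔Q (xs-unique , ∈xs⇔P) (ys-unique , ∈ys⇔Q) =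
  ∼bag⇒↭ (unique∧set⇒bag (Unique.map⁺ injective xs-unique) ys-unique (mk⇔ image⊆ys ys⊆image))
  where
  open Bijection φ using (to; injective; to⁻; surjection)
  open Surjection surjection using (to∘to⁻)
  open Equivalence using (from)

  image⊆ys : ∀ {z} → z ∈ map to xs → z ∈ ys
  image⊆ys z∈ with ∈-map⁻ to z∈
  ... | x , x∈xs , refl = from ∈ys⇔Q (Equivalence.to (P⇔Q x) (Equivalence.to ∈xs⇔P x∈xs))

  ys⊆image : ∀ {z} → z ∈ ys → z ∈ map to xs
  ys⊆image {z} z∈ys = subst (_∈ map to xs) (to∘to⁻ z) (∈-map⁺ to (from ∈xs⇔P P-preimage))
    where
    P-preimage : P (to⁻ z)
    P-preimage = from (P⇔Q (to⁻ z)) (subst Q (sym (to∘to⁻ z)) (Equivalence.to ∈ys⇔Q z∈ys))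

subtree : ∀ {F} → Node F → PlaneTree
subtree (root {f}) = node f
subtree (inside x) = subtree x
subtree (later x)  = subtree x

roots : (F : PlaneForest) → List (Node F)
roots []            = []
roots (node f ∷ ts) = root ∷ map later (roots ts)

children : ∀ {F} → Node F → List (Node F)
children (root {f}) = map inside (roots f)
children (inside x) = map inside (children x)
children (later x)  = map later (children x)

map-subtree-roots : ∀ F → map subtree (roots F) ≡ F
map-subtree-roots []            = refl
map-subtree-roots (node f ∷ ts) =
  cong (node f ∷_) (≡.trans (sym (map-∘ (roots ts))) (map-subtree-roots ts))

subtree≡node-children : ∀ {F} (x : Node F) → subtree x ≡ node (map subtree (children x))
subtree≡node-children (root {f}) =
  cong node (sym (≡.trans (sym (map-∘ (roots f))) (map-subtree-roots f)))
subtree≡node-children (inside x) =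
  ≡.trans (subtree≡node-children x) (cong node (map-∘ (children x)))
subtree≡node-children (later x)  =
  ≡.trans (subtree≡node-children x) (cong node (map-∘ (children x)))

inside-injective : ∀ {f ts} {x y : Node f} → inside {f} {ts} x ≡ inside y → x ≡ y
inside-injective refl = refl

later-injective : ∀ {t ts} {x y : Node ts} → later {t} x ≡ later y → x ≡ y
later-injective refl = refl

root∉map-later : ∀ {f ts} (ys : List (Node ts)) → All (root {f} ≢_) (map later ys)
root∉map-later []       = []
root∉map-later (y ∷ ys) = (λ ()) ∷ root∉map-later ys

roots-unique : ∀ F → Unique (roots F)
roots-unique []            = []
roots-unique (node f ∷ ts) =
  root∉map-later (roots ts) ∷ Unique.map⁺ later-injective (roots-unique ts)

children-unique : ∀ {F} (x : Node F) → Unique (children x)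
children-unique (root {f}) = Unique.map⁺ inside-injective (roots-unique f)
children-unique (inside x) = Unique.map⁺ inside-injective (children-unique x)
children-unique (later x)  = Unique.map⁺ later-injective (children-unique x)

IsRoot⇒∈roots : ∀ {F} {y : Node F} → IsRoot y → y ∈ roots F
IsRoot⇒∈roots root-isRoot                    = here refl
IsRoot⇒∈roots (later-isRoot {t = node _} r) = there (∈-map⁺ later (IsRoot⇒∈roots r))

∈roots⇒IsRoot : ∀ {F} {y : Node F} → y ∈ roots F → IsRoot y
∈roots⇒IsRoot {node f ∷ ts} (here refl) = root-isRoot
∈roots⇒IsRoot {node f ∷ ts} (there y∈) with ∈-map⁻ later y∈
... | z , z∈ , refl = later-isRoot (∈roots⇒IsRoot z∈)

Parent⇒∈children : ∀ {F} {x y : Node F} → Parent y x → y ∈ children x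
Parent⇒∈children (top r)  = ∈-map⁺ inside (IsRoot⇒∈roots r)
Parent⇒∈children (deep p) = ∈-map⁺ inside (Parent⇒∈children p)
Parent⇒∈children (next p) = ∈-map⁺ later (Parent⇒∈children p)

∈children⇒Parent : ∀ {F} {x y : Node F} → y ∈ children x → Parent y x
∈children⇒Parent {x = root} y∈ with ∈-map⁻ inside y∈
... | z , z∈ , refl = top (∈roots⇒IsRoot z∈)
∈children⇒Parent {x = inside x} y∈ with ∈-map⁻ inside y∈
... | z , z∈ , refl = deep (∈children⇒Parent z∈)
∈children⇒Parent {x = later x} y∈ with ∈-map⁻ later y∈
... | z , z∈ , refl = next (∈children⇒Parent z∈)

roots-enumerates : ∀ F → Enumerates IsRoot (roots F)
roots-enumerates F = roots-unique F , mk⇔ ∈roots⇒IsRoot IsRoot⇒∈roots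

children-enumerates : ∀ {F} (x : Node F) → Enumerates (λ y → Parent y x) (children x)
children-enumerates x = children-unique x , mk⇔ ∈children⇒Parent Parent⇒∈children

node-injective : ∀ {f g} → node f ≡ node g → f ≡ g
node-injective refl = refl

module _ {F G : PlaneForest} (φ : NonPlaneIso F G) where
  open NonPlaneIso φ

  roots-↭ : map to (roots F) ↭ roots G
  roots-↭ = map-enumerates-↭ bij root-pres (roots-enumerates F) (roots-enumerates G)

  children-↭ : ∀ x → map to (children x) ↭ children (to x)
  children-↭ x = map-enumerates-↭ bij (λ y → parent-pres y x)
                   (children-enumerates x) (children-enumerates (to x))

  -- The index t makes the recursion structural on the subtree at x.
  mutual
    subtree≈ : ∀ {t} (x : Node F) → subtree x ≡ t → subtree x ≈T subtree (to x)
    subtree≈ {node f} x x↦t =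
      subst₂ _≈T_ (sym (subtree≡node-children x)) (sym (subtree≡node-children (to x)))
        (node≈ (≈F-trans (subtrees≈ (children x) children↦f)
                         (permute (↭.map⁺ subtree (children-↭ x)))))
      where
      children↦f : map subtree (children x) ≡ f
      children↦f = node-injective (≡.trans (sym (subtree≡node-children x)) x↦t)

    subtrees≈ : ∀ {f} (xs : List (Node F)) → map subtree xs ≡ f →
                map subtree xs ≈F map subtree (map to xs)
    subtrees≈ {[]}    []       refl   = []
    subtrees≈ {_ ∷ _} (x ∷ xs) xs↦f =
      subtree≈ x (proj₁ (∷-injective xs↦f)) ∷ subtrees≈ xs (proj₂ (∷-injective xs↦f))

  NonPlaneIso⇒≈F : F ≈F G
  NonPlaneIso⇒≈F =
    subst₂ _≈F_ (map-subtree-roots F) (map-subtree-roots G)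
      (≈F-trans (subtrees≈ (roots F) (map-subtree-roots F))
                (permute (↭.map⁺ subtree roots-↭)))

mainTheorem3 : (A B : ArchSystem) → NonPlaneIso (forestOf A) (forestOf B) → A ∼ B
mainTheorem3 A B φ =
  subst₂ _∼_ (archOf-forestOf A) (archOf-forestOf B)
    (≋⇒∼ (≈F⇒≋ (NonPlaneIso⇒≈F φ)))
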